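{- Let $m \ge 1$ and let $C$ be a binary LCD $[2m+3,2]$ code with $d(C^\perp)\ge 2$. Then there is a $2$-cover $(Y_1,Y_2)$ of the $m$-set $X=\{1,\dots,m\}$ such that $C$ is equivalent to $C'((Y_1,Y_2))$.
   Context: A $2$-cover of $X$ is a sequence $(Y_1,Y_2)$ of (not necessarily distinct) subsets of $X$ with $Y_1\cup Y_2=X$. For a positive integer $a$ write $a+Y=\{a+y\mid y\in Y\}$. Set $Z_i=\{i\}\cup(2+Y_i)\cup(2+m+Y_i)\subseteq\{1,\dots,2m+2\}$ for $i=1,2$, let $z_i\in\mathbb{F}_2^{2m+2}$ be the characteristic vector of $Z_i$, and let $G$ be the $2\times(2m+2)$ matrix with rows $z_1,z_2$. $C'((Y_1,Y_2))$ is the binary $[2m+3,2]$ code generated by the rows of the $2\times(2m+3)$ matrix obtained by appending to $G$ the column $(1,1)^T$. A binary $[n,k]$ code is a $k$-dimensional subspace of $\mathbb{F}_2^n$; $C$ is LCD if $C\cap C^\perp=\{\mathbf{0}_n\}$; $d(D)$ is the minimum nonzero Hamming weight of $D$. Two binary codes are equivalent if one is obtained from the other by a permutation of coordinates. -}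

module Defs where

open import Data.Bool using (Bool; true; false; _∧_; _∨_; _xor_; if_then_else_)
open import Data.Nat using (ℕ; zero; suc; _+_; _*_; _∸_; _≤_; _<_; _<?_; _≡ᵇ_)
open import Data.Fin using (Fin; toℕ; fromℕ<)
open import Data.Fin.Permutation using (Permutation′; _⟨$⟩ʳ_)
open import Data.Product using (Σ; ∃; _×_; _,_)
open import Function.Bundles using (_⇔_)
open import Relation.Nullary using (¬_; yes; no)
open import Relation.Binary.PropositionalEquality using (_≡_)

-- Vectors of F_2^n: false = 0, true = 1; addition is xor, multiplication is ∧.
Word : ℕ → Set
Word n = Fin n → Bool

⨁ : (n : ℕ) → (Fin n → Bool) → Bool
⨁ zero    f = false
⨁ (suc n) f = f Data.Fin.zero xor ⨁ n (λ i → f (Data.Fin.suc i))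

dot : {n : ℕ} → Word n → Word n → Bool
dot {n} u v = ⨁ n (λ j → u j ∧ v j)

IsZero : {n : ℕ} → Word n → Set
IsZero v = ∀ j → v j ≡ false

weight : {n : ℕ} → Word n → ℕ
weight {zero}  v = 0
weight {suc n} v = (if v Data.Fin.zero then 1 else 0) + weight (λ i → v (Data.Fin.suc i))

lincomb : {n k : ℕ} → (Fin k → Word n) → (Fin k → Bool) → Word n
lincomb {n} {k} g c j = ⨁ k (λ i → c i ∧ g i j)

InSpan : {n k : ℕ} → (Fin k → Word n) → Word n → Set
InSpan {n} {k} g v = Σ (Fin k → Bool) λ c → ∀ j → v j ≡ lincomb g c j

LinIndep : {n k : ℕ} → (Fin k → Word n) → Set
LinIndep {n} {k} g = ∀ (c : Fin k → Bool) → IsZero (lincomb g c) → ∀ i → c i ≡ false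

Code : ℕ → Set₁
Code n = Word n → Set

IsLinearCode : (n k : ℕ) → Code n → Set
IsLinearCode n k C =
  Σ (Fin k → Word n) λ g → LinIndep g × (∀ v → C v ⇔ InSpan g v)

Dual : {n : ℕ} → Code n → Code n
Dual C v = ∀ u → C u → dot u v ≡ false

IsLCD : {n : ℕ} → Code n → Set
IsLCD C = ∀ v → C v → Dual C v → IsZero v

MinDistGe : {n : ℕ} → Code n → ℕ → Set
MinDistGe D d = ∀ v → D v → ¬ IsZero v → d ≤ weight v

Equivalent : {n : ℕ} → Code n → Code n → Set
Equivalent {n} C D = Σ (Permutation′ n) λ σ → ∀ v → C v ⇔ D (λ j → v (σ ⟨$⟩ʳ j))

-- subsets of X = {1,…,m}, with element x+1 represented by x : Fin m
SubsetX : ℕ → Set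
SubsetX m = Fin m → Bool

-- is the (1-based) number p an element of Y ⊆ {1,…,m}?
memℕ : {m : ℕ} → SubsetX m → ℕ → Bool
memℕ {m} Y zero = false
memℕ {m} Y (suc p) with p <? m
... | yes p<m = Y (fromℕ< p<m)
... | no  _   = false

Is2Cover : {m : ℕ} → SubsetX m → SubsetX m → Set
Is2Cover {m} Y₁ Y₂ = ∀ x → Y₁ x ∨ Y₂ x ≡ true

-- characteristic vector of Z_i = {i} ∪ (2+Y_i) ∪ (2+m+Y_i) ⊆ {1,…,2m+2}
-- at the 1-based position p (i ∈ {1,2})
zℕ : {m : ℕ} → ℕ → SubsetX m → ℕ → Bool
-- (memℕ Y 0 = false and memℕ Y q = false for q > m, so truncated
-- subtraction correctly encodes p ∈ 2+Y and p ∈ 2+m+Y)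
zℕ {m} i Y p = (p ≡ᵇ i) ∨ memℕ Y (p ∸ 2) ∨ memℕ Y (p ∸ (2 + m))

-- row of the generator matrix of C'((Y_1,Y_2)) of length 2m+3:
-- z_i followed by the extra coordinate 1 (0-based position 2m+2)
row : {m : ℕ} → ℕ → SubsetX m → Word (2 * m + 3)
row {m} i Y j with toℕ j ≡ᵇ (2 * m + 2)
... | true  = true
... | false = zℕ i Y (suc (toℕ j))

C′-gen : {m : ℕ} → SubsetX m → SubsetX m → Fin 2 → Word (2 * m + 3)
C′-gen Y₁ Y₂ Data.Fin.zero = row 1 Y₁
C′-gen Y₁ Y₂ (Data.Fin.suc _) = row 2 Y₂

C′ : {m : ℕ} → SubsetX m → SubsetX m → Code (2 * m + 3)
C′ Y₁ Y₂ = InSpan (C′-gen Y₁ Y₂)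

module Submission where

-- A generator pair g₀, g₁ of C is described by its columns, vectors of F₂². Dual distance ≥ 2
-- rules out the zero column, so C is determined up to equivalence by the numbers of columns of
-- types (1,0), (0,1) and (1,1). The Gram matrix of g₀, g₁ depends only on the parities of these
-- numbers, and C is LCD iff that matrix is nonsingular; together with the odd length 2m+3 this
-- forces all three numbers to be odd, say 2a+1, 2b+1, 2c+1 with a+b+c = m. For the 2-cover with
-- a points only in Y₁, b only in Y₂ and c in both, the generator matrix of C′((Y₁,Y₂)) has
-- exactly these column counts, so it is a column permutation of (g₀, g₁).

open import Defs
open import Data.Nat using (ℕ; _*_; _+_; _≤_)
open import Data.Product using (Σ; _×_)
open import Data.Nat using (zero; suc; _∸_; _<_; _<?_; _≡ᵇ_; s≤s; z≤n)
open import Data.Nat.Properties as ℕ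
  using (+-assoc; +-suc; +-identityʳ; +-cancelʳ-≡; *-cancelˡ-≡; +-cancelˡ-≡; ≤-trans; m≤m+n;
         +-monoʳ-<; <⇒≢; m≤n⇒m∸n≡0; m+n∸m≡n; 0∸n≡0; +-commutativeSemigroup)
open import Data.Nat.Tactic.RingSolver using (solve-∀)
open import Data.Bool using (Bool; true; false; not; _∧_; _∨_; _xor_; if_then_else_; T)
open import Data.Bool.Properties
  using (_≟_; ∧-idem; ∧-comm; ∧-zeroʳ; ∨-identityʳ; ∧-distribˡ-xor; ∧-distribʳ-xor; ∧-assoc;
         not-distribˡ-xor; not-involutive; xor-same; xor-identityʳ; xor-∧-commutativeRing)
open import Data.Fin using (Fin; toℕ; punchIn) renaming (zero to fz; suc to fs)
open import Data.Fin.Properties using (toℕ<n; fromℕ<-toℕ)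
open import Data.Fin.Permutation using (Permutation′; _⟨$⟩ʳ_; _⟨$⟩ˡ_; insert; insert-punchIn; inverseʳ)
  renaming (id to idₚ)
open import Data.Product using (∃; _,_; proj₁; proj₂)
open import Data.Product.Properties using (≡-dec)
open import Data.Empty using (⊥-elim)
open import Data.Unit using (tt)
open import Function using (_∘_)
open import Function.Bundles using (_⇔_; Equivalence; mk⇔)
import Function.Properties.Equivalence as ⇔
open import Relation.Binary.Definitions using (DecidableEquality)
open import Relation.Binary.PropositionalEquality
open import Relation.Nullary using (¬_; does; yes; no)
open import Relation.Nullary.Decidable using (dec-true; dec-false)
open import Algebra.Bundles using (CommutativeRing)
import Algebra.Properties.CommutativeSemigroup as CommSemigroupProperties

open ≡-Reasoning

⨁-cong : ∀ n {f f′ : Fin n → Bool} → (∀ j → f j ≡ f′ j) → ⨁ n f ≡ ⨁ n f′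
⨁-cong zero    e = refl
⨁-cong (suc n) e = cong₂ _xor_ (e fz) (⨁-cong n (e ∘ fs))

⨁-zero : ∀ n {f : Fin n → Bool} → (∀ j → f j ≡ false) → ⨁ n f ≡ false
⨁-zero zero    e = refl
⨁-zero (suc n) e = cong₂ _xor_ (e fz) (⨁-zero n (e ∘ fs))

⨁-xor : ∀ n (f f′ : Fin n → Bool) → ⨁ n (λ j → f j xor f′ j) ≡ ⨁ n f xor ⨁ n f′
⨁-xor zero    f f′ = refl
⨁-xor (suc n) f f′ = begin
  (f fz xor f′ fz) xor ⨁ n (λ j → f (fs j) xor f′ (fs j))
    ≡⟨ cong ((f fz xor f′ fz) xor_) (⨁-xor n (f ∘ fs) (f′ ∘ fs)) ⟩
  (f fz xor f′ fz) xor (⨁ n (f ∘ fs) xor ⨁ n (f′ ∘ fs))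
    ≡⟨ interchange (f fz) (f′ fz) _ _ ⟩
  (f fz xor ⨁ n (f ∘ fs)) xor (f′ fz xor ⨁ n (f′ ∘ fs)) ∎
  where open CommSemigroupProperties (CommutativeRing.+-commutativeSemigroup xor-∧-commutativeRing)

⨁-∧ʳ : ∀ n (f : Fin n → Bool) a → ⨁ n f ∧ a ≡ ⨁ n (λ j → f j ∧ a)
⨁-∧ʳ zero    f a = refl
⨁-∧ʳ (suc n) f a = trans (∧-distribʳ-xor a (f fz) _) (cong ((f fz ∧ a) xor_) (⨁-∧ʳ n (f ∘ fs) a))

⨁-∧ˡ : ∀ n a (f : Fin n → Bool) → a ∧ ⨁ n f ≡ ⨁ n (λ j → a ∧ f j)
⨁-∧ˡ zero    a f = ∧-zeroʳ a
⨁-∧ˡ (suc n) a f = trans (∧-distribˡ-xor a (f fz) _) (cong ((a ∧ f fz) xor_) (⨁-∧ˡ n a (f ∘ fs)))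

⨁-comm : ∀ n k (h : Fin k → Fin n → Bool) →
  ⨁ n (λ j → ⨁ k (λ i → h i j)) ≡ ⨁ k (λ i → ⨁ n (h i))
⨁-comm n zero    h = ⨁-zero n (λ _ → refl)
⨁-comm n (suc k) h = trans (⨁-xor n (h fz) _) (cong (⨁ n (h fz) xor_) (⨁-comm n k (h ∘ fs)))

odd : ℕ → Bool
odd zero    = false
odd (suc n) = not (odd n)

odd-+ : ∀ a b → odd (a + b) ≡ odd a xor odd b
odd-+ zero    b = refl
odd-+ (suc a) b = trans (cong not (odd-+ a b)) (not-distribˡ-xor (odd a) (odd b))

odd[2*m+3] : ∀ m → odd (2 * m + 3) ≡ true
odd[2*m+3] m = begin
  odd (m + (m + 0) + 3)        ≡⟨ odd-+ (m + (m + 0)) 3 ⟩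
  odd (m + (m + 0)) xor true   ≡⟨ cong (_xor true) (odd-+ m (m + 0)) ⟩
  (odd m xor odd (m + 0)) xor true
    ≡⟨ cong (λ k → (odd m xor odd k) xor true) (+-identityʳ m) ⟩
  (odd m xor odd m) xor true   ≡⟨ cong (_xor true) (xor-same (odd m)) ⟩
  true ∎

odd⇒suc-double : ∀ k → odd k ≡ true → ∃ λ a → k ≡ suc (a + a)
odd⇒suc-double (suc zero)    _ = 0 , refl
odd⇒suc-double (suc (suc k)) e
  with a , k≡ ← odd⇒suc-double k (trans (sym (not-involutive (odd k))) e)
  = suc a , cong (suc ∘ suc) (trans k≡ (sym (+-suc a a)))

weight-cong : ∀ {n} {u v : Word n} → (∀ j → u j ≡ v j) → weight u ≡ weight v
weight-cong {zero}  e = refl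
weight-cong {suc n} e = cong₂ (λ b w → (if b then 1 else 0) + w) (e fz) (weight-cong (e ∘ fs))

weight-false : ∀ n → weight {n} (λ _ → false) ≡ 0
weight-false zero    = refl
weight-false (suc n) = weight-false n

weight-true : ∀ n → weight {n} (λ _ → true) ≡ n
weight-true zero    = refl
weight-true (suc n) = cong suc (weight-true n)

weight-∧-comm : ∀ {n} (u v : Word n) → weight (λ j → u j ∧ v j) ≡ weight (λ j → v j ∧ u j)
weight-∧-comm u v = weight-cong (λ j → ∧-comm (u j) (v j))

weight-split : ∀ {n} (u v : Word n) →
  weight u ≡ weight (λ j → u j ∧ v j) + weight (λ j → u j ∧ not (v j))
weight-split {zero}  u v = refl
weight-split {suc n} u v with u fz | v fz | weight-split (u ∘ fs) (v ∘ fs)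
... | false | _     | ih = ih
... | true  | true  | ih = cong suc ih
... | true  | false | ih = trans (cong suc ih) (sym (+-suc _ _))

weight-punchIn : ∀ {n} (v : Word (suc n)) i →
  weight v ≡ (if v i then 1 else 0) + weight (λ k → v (punchIn i k))
weight-punchIn         v fz     = refl
weight-punchIn {suc n} v (fs i) = trans (cong ((if v fz then 1 else 0) +_) (weight-punchIn (v ∘ fs) i))
                                        (x∙yz≈y∙xz (if v fz then 1 else 0) (if v (fs i) then 1 else 0) _)
  where open CommSemigroupProperties +-commutativeSemigroup

weight-positive : ∀ {n k} (v : Word n) → weight v ≡ suc k → ∃ λ j → T (v j)
weight-positive {suc n} v e with v fz in v₀
... | true  = fz , subst T (sym v₀) tt
... | false = let j , vj = weight-positive (v ∘ fs) e in fs j , vj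

⨁≡odd-weight : ∀ n (v : Word n) → ⨁ n v ≡ odd (weight v)
⨁≡odd-weight zero    v = refl
⨁≡odd-weight (suc n) v with v fz
... | true  = cong not (⨁≡odd-weight n (v ∘ fs))
... | false = ⨁≡odd-weight n (v ∘ fs)

dot≡odd-weight : ∀ {n} (u v : Word n) → dot u v ≡ odd (weight (λ j → u j ∧ v j))
dot≡odd-weight {n} u v = ⨁≡odd-weight n (λ j → u j ∧ v j)

dot-comm : ∀ {n} (u v : Word n) → dot u v ≡ dot v u
dot-comm {n} u v = ⨁-cong n (λ j → ∧-comm (u j) (v j))

dot-congˡ : ∀ {n} {u u′ : Word n} (v : Word n) → (∀ j → u j ≡ u′ j) → dot u v ≡ dot u′ v
dot-congˡ {n} v e = ⨁-cong n (λ j → cong (_∧ v j) (e j))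

dot-lincombˡ : ∀ {n k} (g : Fin k → Word n) (c : Fin k → Bool) (w : Word n) →
  dot (lincomb g c) w ≡ ⨁ k (λ i → c i ∧ dot (g i) w)
dot-lincombˡ {n} {k} g c w = begin
  ⨁ n (λ j → ⨁ k (λ i → c i ∧ g i j) ∧ w j)
    ≡⟨ ⨁-cong n (λ j → ⨁-∧ʳ k (λ i → c i ∧ g i j) (w j)) ⟩
  ⨁ n (λ j → ⨁ k (λ i → (c i ∧ g i j) ∧ w j))
    ≡⟨ ⨁-comm n k (λ i j → (c i ∧ g i j) ∧ w j) ⟩
  ⨁ k (λ i → ⨁ n (λ j → (c i ∧ g i j) ∧ w j))
    ≡⟨ ⨁-cong k (λ i → trans (⨁-cong n (λ j → ∧-assoc (c i) (g i j) (w j))) (sym (⨁-∧ˡ n (c i) _))) ⟩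
  ⨁ k (λ i → c i ∧ dot (g i) w) ∎

unitWord : ∀ {n} → Fin n → Word n
unitWord fz     fz     = true
unitWord fz     (fs _) = false
unitWord (fs i) fz     = false
unitWord (fs i) (fs j) = unitWord i j

unitWord-self : ∀ {n} (i : Fin n) → unitWord i i ≡ true
unitWord-self fz     = refl
unitWord-self (fs i) = unitWord-self i

weight-unitWord : ∀ {n} (i : Fin n) → weight (unitWord i) ≡ 1
weight-unitWord {suc n} fz     = cong suc (weight-false n)
weight-unitWord {suc n} (fs i) = weight-unitWord i

dot-unitWordʳ : ∀ {n} (u : Word n) (i : Fin n) → dot u (unitWord i) ≡ u i
dot-unitWordʳ {suc n} u fz =
  trans (cong₂ _xor_ (∧-comm (u fz) true) (⨁-zero n (λ j → ∧-zeroʳ (u (fs j))))) (xor-identityʳ (u fz))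
dot-unitWordʳ {suc n} u (fs i) =
  trans (cong (_xor dot (u ∘ fs) (unitWord i)) (∧-zeroʳ (u fz))) (dot-unitWordʳ (u ∘ fs) i)

gram : ∀ {n k} → (Fin k → Word n) → Fin k → Fin k → Bool
gram g i l = dot (g i) (g l)

Nonsingular : ∀ {k} → (Fin k → Fin k → Bool) → Set
Nonsingular {k} G = ∀ (x : Fin k → Bool) → (∀ i → ⨁ k (λ l → x l ∧ G l i) ≡ false) → ∀ l → x l ≡ false

Nonsingular-cong : ∀ {k} {G G′ : Fin k → Fin k → Bool} →
  (∀ i l → G i l ≡ G′ i l) → Nonsingular G → Nonsingular G′
Nonsingular-cong {k} G≡G′ ns x xG′≡0 =
  ns x (λ i → trans (⨁-cong k (λ l → cong (x l ∧_) (G≡G′ l i))) (xG′≡0 i))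

lcd⇒nonsingular-gram : ∀ {n k} {C : Code n} (g : Fin k → Word n) → LinIndep g →
  (∀ v → C v ⇔ InSpan g v) → IsLCD C → Nonsingular (gram g)
lcd⇒nonsingular-gram {n} {k} {C} g indep span lcd x xG≡0 = indep x (lcd w w∈C w∈C⊥)
  where
  w : Word n
  w = lincomb g x

  w∈C : C w
  w∈C = Equivalence.from (span w) (x , λ _ → refl)

  w∈C⊥ : Dual C w
  w∈C⊥ u u∈C with d , u≡ ← Equivalence.to (span u) u∈C = begin
    dot u w                          ≡⟨ dot-congˡ w u≡ ⟩
    dot (lincomb g d) w              ≡⟨ dot-lincombˡ g d w ⟩
    ⨁ k (λ i → d i ∧ dot (g i) w)   ≡⟨ ⨁-zero k gᵢ⊥w ⟩
    false ∎
    where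
    gᵢ⊥w : ∀ i → d i ∧ dot (g i) w ≡ false
    gᵢ⊥w i = begin
      d i ∧ dot (g i) w                      ≡⟨ cong (d i ∧_) (dot-comm (g i) w) ⟩
      d i ∧ dot w (g i)                      ≡⟨ cong (d i ∧_) (dot-lincombˡ g x (g i)) ⟩
      d i ∧ ⨁ k (λ l → x l ∧ gram g l i)    ≡⟨ cong (d i ∧_) (xG≡0 i) ⟩
      d i ∧ false                            ≡⟨ ∧-zeroʳ (d i) ⟩
      false ∎

-- The unit vector at a zero column of the generator matrix would be a dual codeword of weight 1.
dual-distance≥2⇒column≢0 : ∀ {n k} {C : Code n} (g : Fin k → Word n) →
  (∀ v → C v ⇔ InSpan g v) → MinDistGe (Dual C) 2 → ∀ j → ¬ (∀ i → g i j ≡ false)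
dual-distance≥2⇒column≢0 {n} {k} {C} g span d⊥≥2 j column≡0 =
  ℕ.1+n≰n (subst (2 ≤_) (weight-unitWord j) (d⊥≥2 (unitWord j) eⱼ∈C⊥ eⱼ≢0))
  where
  eⱼ∈C⊥ : Dual C (unitWord j)
  eⱼ∈C⊥ u u∈C with d , u≡ ← Equivalence.to (span u) u∈C =
    trans (dot-unitWordʳ u j)
      (trans (u≡ j) (⨁-zero k (λ i → trans (cong (d i ∧_) (column≡0 i)) (∧-zeroʳ (d i)))))

  eⱼ≢0 : ¬ IsZero (unitWord j)
  eⱼ≢0 eⱼ≡0 with () ← trans (sym (unitWord-self j)) (eⱼ≡0 j)

InSpan-permute : ∀ {n k} (g h : Fin k → Word n) (σ : Permutation′ n) →
  (∀ i j → h i j ≡ g i (σ ⟨$⟩ʳ j)) → ∀ v → InSpan g v ⇔ InSpan h (λ j → v (σ ⟨$⟩ʳ j))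
InSpan-permute {n} {k} g h σ h≡gσ v = mk⇔ to from
  where
  lincomb-permute : ∀ c j → lincomb h c j ≡ lincomb g c (σ ⟨$⟩ʳ j)
  lincomb-permute c j = ⨁-cong k (λ i → cong (c i ∧_) (h≡gσ i j))

  to : InSpan g v → InSpan h (λ j → v (σ ⟨$⟩ʳ j))
  to (c , v≡) = c , λ j → trans (v≡ (σ ⟨$⟩ʳ j)) (sym (lincomb-permute c j))

  from : InSpan h (λ j → v (σ ⟨$⟩ʳ j)) → InSpan g v
  from (c , vσ≡) = c , λ j → begin
    v j                                   ≡⟨ cong v (sym (inverseʳ σ)) ⟩
    v (σ ⟨$⟩ʳ (σ ⟨$⟩ˡ j))                ≡⟨ vσ≡ (σ ⟨$⟩ˡ j) ⟩
    lincomb h c (σ ⟨$⟩ˡ j)               ≡⟨ lincomb-permute c (σ ⟨$⟩ˡ j) ⟩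
    lincomb g c (σ ⟨$⟩ʳ (σ ⟨$⟩ˡ j))      ≡⟨ cong (lincomb g c) (inverseʳ σ) ⟩
    lincomb g c j ∎

module Counting {A : Set} (_≟ₐ_ : DecidableEquality A) where

  δ : A → A → ℕ
  δ s t = if does (s ≟ₐ t) then 1 else 0

  count : ∀ {n} → (Fin n → A) → A → ℕ
  count f t = weight (λ j → does (f j ≟ₐ t))

  count-cong : ∀ {n} {f f′ : Fin n → A} → (∀ j → f j ≡ f′ j) → ∀ t → count f t ≡ count f′ t
  count-cong e t = weight-cong (λ j → cong (λ a → does (a ≟ₐ t)) (e j))

  count-positive : ∀ {n k} (f : Fin n → A) t → count f t ≡ suc k → ∃ λ j → f j ≡ t
  count-positive f t e = let j , ft = weight-positive _ e in j , T-does⇒≡ ft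
    where
    T-does⇒≡ : ∀ {a b} → T (does (a ≟ₐ b)) → a ≡ b
    T-does⇒≡ {a} {b} p with a ≟ₐ b
    ... | yes a≡b = a≡b
    ... | no  _   = ⊥-elim p

  ≗count⇒permutation : ∀ {n} (f g : Fin n → A) → (∀ t → count f t ≡ count g t) →
    Σ (Permutation′ n) λ σ → ∀ j → g j ≡ f (σ ⟨$⟩ʳ j)
  ≗count⇒permutation {zero}  f g _    = idₚ , λ ()
  ≗count⇒permutation {suc n} f g same = insert fz i π , g≡fσ
    where
    g₀-counted : count g (g fz) ≡ suc (count (g ∘ fs) (g fz))
    g₀-counted = cong (λ b → (if b then 1 else 0) + count (g ∘ fs) (g fz)) (dec-true (g fz ≟ₐ g fz) refl)


    g₀∈f : ∃ λ i → f i ≡ g fz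
    g₀∈f = count-positive f (g fz) (trans (same (g fz)) g₀-counted)

    i : Fin (suc n)
    i = proj₁ g₀∈f

    fi≡g₀ : f i ≡ g fz
    fi≡g₀ = proj₂ g₀∈f

    same-rest : ∀ t → count (f ∘ punchIn i) t ≡ count (g ∘ fs) t
    same-rest t = +-cancelˡ-≡ (δ (g fz) t) _ _ (begin
      δ (g fz) t + count (f ∘ punchIn i) t   ≡⟨ cong (λ a → δ a t + count (f ∘ punchIn i) t) (sym fi≡g₀) ⟩
      δ (f i) t + count (f ∘ punchIn i) t    ≡⟨ sym (weight-punchIn (λ j → does (f j ≟ₐ t)) i) ⟩
      count f t                              ≡⟨ same t ⟩
      count g t ∎)

    rest : Σ (Permutation′ n) λ π → ∀ j → g (fs j) ≡ f (punchIn i (π ⟨$⟩ʳ j))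
    rest = ≗count⇒permutation (f ∘ punchIn i) (g ∘ fs) same-rest

    π : Permutation′ n
    π = proj₁ rest

    g≡fσ : ∀ j → g j ≡ f (insert fz i π ⟨$⟩ʳ j)
    g≡fσ fz     = sym fi≡g₀
    g≡fσ (fs j) = trans (proj₂ rest j) (cong f (sym (insert-punchIn fz i π j)))

  countBelow : ℕ → (ℕ → A) → A → ℕ
  countBelow n h = count {n} (h ∘ toℕ)

  countBelow-+ : ∀ a b (h : ℕ → A) t →
    countBelow (a + b) h t ≡ countBelow a h t + countBelow b (λ p → h (a + p)) t
  countBelow-+ zero    b h t = refl
  countBelow-+ (suc a) b h t =
    trans (cong (δ (h 0) t +_) (countBelow-+ a b (h ∘ suc) t)) (sym (+-assoc (δ (h 0) t) _ _))

Column : Set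
Column = Bool × Bool

_≟ᶜ_ : DecidableEquality Column
_≟ᶜ_ = ≡-dec _≟_ _≟_

open Counting _≟ᶜ_

does-≟ᶜ : ∀ a b s t → does ((a , b) ≟ᶜ (s , t)) ≡ does (a ≟ s) ∧ does (b ≟ t)
does-≟ᶜ false b false t = refl
does-≟ᶜ false b true  t = refl
does-≟ᶜ true  b false t = refl
does-≟ᶜ true  b true  t = refl

does-≟ᶜ-00 : ∀ a b → ¬ (a ≡ false × b ≡ false) → does ((a , b) ≟ᶜ (false , false)) ≡ false
does-≟ᶜ-00 true  b     _  = refl
does-≟ᶜ-00 false true  _  = refl
does-≟ᶜ-00 false false ne = ⊥-elim (ne (refl , refl))

does-≟-true : ∀ a → does (a ≟ true) ≡ a
does-≟-true false = refl
does-≟-true true  = refl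

does-≟-false : ∀ a → does (a ≟ false) ≡ not a
does-≟-false false = refl
does-≟-false true  = refl

column : ∀ {n} → (Fin 2 → Word n) → Fin n → Column
column g j = g fz j , g (fs fz) j

columnProfile : ℕ → ℕ → ℕ → Column → ℕ
columnProfile x y z (false , false) = 0
columnProfile x y z (true  , false) = x
columnProfile x y z (false , true)  = y
columnProfile x y z (true  , true)  = z

columnProfile-zero : ∀ t → columnProfile 0 0 0 t ≡ 0
columnProfile-zero (false , false) = refl
columnProfile-zero (true  , false) = refl
columnProfile-zero (false , true)  = refl
columnProfile-zero (true  , true)  = refl

columnProfile-suc : ∀ x y z t →
  δ (true , false) t + columnProfile x y z t ≡ columnProfile (suc x) y z t ×
  δ (false , true) t + columnProfile x y z t ≡ columnProfile x (suc y) z t ×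
  δ (true , true)  t + columnProfile x y z t ≡ columnProfile x y (suc z) t
columnProfile-suc x y z (false , false) = refl , refl , refl
columnProfile-suc x y z (true  , false) = refl , refl , refl
columnProfile-suc x y z (false , true)  = refl , refl , refl
columnProfile-suc x y z (true  , true)  = refl , refl , refl

-- The Gram matrix of a generator pair whose columns of types (1,0), (0,1), (1,1) occur
-- with parities a, b, c.
gram₂ : Bool → Bool → Bool → Fin 2 → Fin 2 → Bool
gram₂ a b c fz     fz     = c xor a
gram₂ a b c fz     (fs _) = c
gram₂ a b c (fs _) fz     = c
gram₂ a b c (fs _) (fs _) = c xor b

nonsingular-gram₂ : ∀ a b c → (c xor a) xor b ≡ true → Nonsingular (gram₂ a b c) →
  a ≡ true × b ≡ true × c ≡ true
nonsingular-gram₂ true  true  true  _  _  = refl , refl , refl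
nonsingular-gram₂ true  false false _  ns
  with () ← ns (λ { fz → false ; (fs _) → true }) (λ { fz → refl ; (fs fz) → refl }) (fs fz)
nonsingular-gram₂ false true  false _  ns
  with () ← ns (λ { fz → true ; (fs _) → false }) (λ { fz → refl ; (fs fz) → refl }) fz
nonsingular-gram₂ false false true  _  ns
  with () ← ns (λ _ → true) (λ { fz → refl ; (fs fz) → refl }) fz
nonsingular-gram₂ true  true  false () _
nonsingular-gram₂ true  false true  () _
nonsingular-gram₂ false true  true  () _
nonsingular-gram₂ false false false () _

module TwoRowCode {n : ℕ} (g : Fin 2 → Word n) where

  private
    g₀ g₁ : Word n
    g₀ = g fz
    g₁ = g (fs fz)

    N : Column → ℕ
    N = count (column g)

    N-literals : ∀ s t → N (s , t) ≡ weight (λ j → does (g₀ j ≟ s) ∧ does (g₁ j ≟ t))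
    N-literals s t = weight-cong (λ j → does-≟ᶜ (g₀ j) (g₁ j) s t)

    N-TT : N (true , true) ≡ weight (λ j → g₀ j ∧ g₁ j)
    N-TT = trans (N-literals true true)
                 (weight-cong (λ j → cong₂ _∧_ (does-≟-true (g₀ j)) (does-≟-true (g₁ j))))

    N-TF : N (true , false) ≡ weight (λ j → g₀ j ∧ not (g₁ j))
    N-TF = trans (N-literals true false)
                 (weight-cong (λ j → cong₂ _∧_ (does-≟-true (g₀ j)) (does-≟-false (g₁ j))))

    N-FT : N (false , true) ≡ weight (λ j → not (g₀ j) ∧ g₁ j)
    N-FT = trans (N-literals false true)
                 (weight-cong (λ j → cong₂ _∧_ (does-≟-false (g₀ j)) (does-≟-true (g₁ j))))

    N-FF : N (false , false) ≡ weight (λ j → not (g₀ j) ∧ not (g₁ j))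
    N-FF = trans (N-literals false false)
                 (weight-cong (λ j → cong₂ _∧_ (does-≟-false (g₀ j)) (does-≟-false (g₁ j))))

    weight-g₀ : weight g₀ ≡ N (true , true) + N (true , false)
    weight-g₀ = trans (weight-split g₀ g₁) (sym (cong₂ _+_ N-TT N-TF))

    weight-g₁ : weight g₁ ≡ N (true , true) + N (false , true)
    weight-g₁ = trans (weight-split g₁ g₀)
                      (sym (cong₂ _+_ (trans N-TT (weight-∧-comm g₀ g₁))
                                      (trans N-FT (weight-∧-comm (not ∘ g₀) g₁))))

  length≡column-counts : n ≡ (N (true , true) + N (true , false)) + (N (false , true) + N (false , false))
  length≡column-counts = begin
    n                                  ≡⟨ sym (weight-true n) ⟩
    weight {n} (λ _ → true)            ≡⟨ weight-split (λ _ → true) g₀ ⟩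
    weight g₀ + weight (not ∘ g₀)      ≡⟨ cong₂ _+_ weight-g₀ (weight-split (not ∘ g₀) g₁) ⟩
    (N (true , true) + N (true , false)) +
      (weight (λ j → not (g₀ j) ∧ g₁ j) + weight (λ j → not (g₀ j) ∧ not (g₁ j)))
      ≡⟨ cong ((N (true , true) + N (true , false)) +_) (sym (cong₂ _+_ N-FT N-FF)) ⟩
    (N (true , true) + N (true , false)) + (N (false , true) + N (false , false)) ∎

  gram≡gram₂ : ∀ i l →
    gram g i l ≡ gram₂ (odd (N (true , false))) (odd (N (false , true))) (odd (N (true , true))) i l
  gram≡gram₂ fz fz = begin
    dot g₀ g₀                                 ≡⟨ dot≡odd-weight g₀ g₀ ⟩
    odd (weight (λ j → g₀ j ∧ g₀ j))          ≡⟨ cong odd (trans (weight-cong (∧-idem ∘ g₀)) weight-g₀) ⟩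
    odd (N (true , true) + N (true , false))  ≡⟨ odd-+ (N (true , true)) (N (true , false)) ⟩
    odd (N (true , true)) xor odd (N (true , false)) ∎
  gram≡gram₂ fz      (fs fz) = trans (dot≡odd-weight g₀ g₁) (cong odd (sym N-TT))
  gram≡gram₂ (fs fz) fz      = trans (dot-comm g₁ g₀) (gram≡gram₂ fz (fs fz))
  gram≡gram₂ (fs fz) (fs fz) = begin
    dot g₁ g₁                                 ≡⟨ dot≡odd-weight g₁ g₁ ⟩
    odd (weight (λ j → g₁ j ∧ g₁ j))          ≡⟨ cong odd (trans (weight-cong (∧-idem ∘ g₁)) weight-g₁) ⟩
    odd (N (true , true) + N (false , true))  ≡⟨ odd-+ (N (true , true)) (N (false , true)) ⟩
    odd (N (true , true)) xor odd (N (false , true)) ∎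

  no-zero-column : (∀ j → ¬ (∀ i → g i j ≡ false)) → N (false , false) ≡ 0
  no-zero-column column≢0 = trans (weight-cong not-00) (weight-false n)
    where
    not-00 : ∀ j → does (column g j ≟ᶜ (false , false)) ≡ false
    not-00 j = does-≟ᶜ-00 (g₀ j) (g₁ j) (λ (e₀ , e₁) → column≢0 j (λ { fz → e₀ ; (fs fz) → e₁ }))

  odd-column-counts : Nonsingular (gram g) → N (false , false) ≡ 0 → odd n ≡ true →
    odd (N (true , false)) ≡ true × odd (N (false , true)) ≡ true × odd (N (true , true)) ≡ true
  odd-column-counts ns N₀₀≡0 n-odd =
    nonsingular-gram₂ _ _ _ parity (Nonsingular-cong gram≡gram₂ ns)
    where
    parity : (odd (N (true , true)) xor odd (N (true , false))) xor odd (N (false , true)) ≡ true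
    parity = begin
      (odd (N (true , true)) xor odd (N (true , false))) xor odd (N (false , true))
        ≡⟨ cong (_xor odd (N (false , true))) (sym (odd-+ (N (true , true)) (N (true , false)))) ⟩
      odd (N (true , true) + N (true , false)) xor odd (N (false , true))
        ≡⟨ sym (odd-+ (N (true , true) + N (true , false)) (N (false , true))) ⟩
      odd ((N (true , true) + N (true , false)) + N (false , true))
        ≡⟨ cong (λ k → odd ((N (true , true) + N (true , false)) + k))
                (sym (trans (cong (N (false , true) +_) N₀₀≡0) (+-identityʳ _))) ⟩
      odd ((N (true , true) + N (true , false)) + (N (false , true) + N (false , false)))
        ≡⟨ cong odd (sym length≡column-counts) ⟩
      odd n ≡⟨ n-odd ⟩
      true ∎

  column-profile : Nonsingular (gram g) → (∀ j → ¬ (∀ i → g i j ≡ false)) → odd n ≡ true →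
    Σ ℕ λ a → Σ ℕ λ b → Σ ℕ λ c → n ≡ (suc (c + c) + suc (a + a)) + (suc (b + b) + 0) ×
      (∀ t → N t ≡ columnProfile (suc (a + a)) (suc (b + b)) (suc (c + c)) t)
  column-profile ns column≢0 n-odd
    with odd₁₀ , odd₀₁ , odd₁₁ ← odd-column-counts ns (no-zero-column column≢0) n-odd
    with a , N₁₀≡ ← odd⇒suc-double _ odd₁₀
    with b , N₀₁≡ ← odd⇒suc-double _ odd₀₁
    with c , N₁₁≡ ← odd⇒suc-double _ odd₁₁
    = a , b , c , n≡ , profile
    where
    N₀₀≡0 : N (false , false) ≡ 0
    N₀₀≡0 = no-zero-column column≢0

    n≡ : n ≡ (suc (c + c) + suc (a + a)) + (suc (b + b) + 0)
    n≡ = trans length≡column-counts (cong₂ _+_ (cong₂ _+_ N₁₁≡ N₁₀≡) (cong₂ _+_ N₀₁≡ N₀₀≡0))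

    profile : ∀ t → N t ≡ columnProfile (suc (a + a)) (suc (b + b)) (suc (c + c)) t
    profile (false , false) = N₀₀≡0
    profile (true  , false) = N₁₀≡
    profile (false , true)  = N₀₁≡
    profile (true  , true)  = N₁₁≡

record OddColumnCounts (m : ℕ) (g : Fin 2 → Word (2 * m + 3)) : Set where
  field
    a b c         : ℕ
    m≡a+[b+c]     : m ≡ a + (b + c)
    column-counts : ∀ t → count (column g) t ≡ columnProfile (suc (a + a)) (suc (b + b)) (suc (c + c)) t

lcd⇒odd-column-counts : ∀ m {C : Code (2 * m + 3)} (g : Fin 2 → Word (2 * m + 3)) → LinIndep g →
  (∀ v → C v ⇔ InSpan g v) → IsLCD C → MinDistGe (Dual C) 2 → OddColumnCounts m g
lcd⇒odd-column-counts m g indep span lcd d⊥≥2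
  with a , b , c , n≡ , counts ← TwoRowCode.column-profile g (lcd⇒nonsingular-gram g indep span lcd)
                                    (dual-distance≥2⇒column≢0 g span d⊥≥2) (odd[2*m+3] m)
  = record { a = a ; b = b ; c = c ; m≡a+[b+c] = m≡ ; column-counts = counts }
  where
  regroup : ∀ a b c → (suc (c + c) + suc (a + a)) + (suc (b + b) + 0) ≡ 2 * (a + (b + c)) + 3
  regroup = solve-∀

  m≡ : m ≡ a + (b + c)
  m≡ = *-cancelˡ-≡ m (a + (b + c)) 2 (+-cancelʳ-≡ 3 (2 * m) _ (trans n≡ (regroup a b c)))

-- The first a points of X lie only in Y₁, the next b only in Y₂, and all others in both.
layout : ℕ → ℕ → ℕ → Column
layout (suc a) b       zero    = true , false
layout (suc a) b       (suc p) = layout a b p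
layout zero    (suc b) zero    = false , true
layout zero    (suc b) (suc p) = layout zero b p
layout zero    zero    p       = true , true

layout-cover : ∀ a b p → proj₁ (layout a b p) ∨ proj₂ (layout a b p) ≡ true
layout-cover (suc a) b       zero    = refl
layout-cover (suc a) b       (suc p) = layout-cover a b p
layout-cover zero    (suc b) zero    = refl
layout-cover zero    (suc b) (suc p) = layout-cover zero b p
layout-cover zero    zero    p       = refl

countBelow-layout : ∀ a b c t → countBelow (a + (b + c)) (layout a b) t ≡ columnProfile a b c t
countBelow-layout (suc a) b c t =
  trans (cong (δ (true , false) t +_) (countBelow-layout a b c t)) (proj₁ (columnProfile-suc a b c t))
countBelow-layout zero (suc b) c t =
  trans (cong (δ (false , true) t +_) (countBelow-layout 0 b c t)) (proj₁ (proj₂ (columnProfile-suc 0 b c t)))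
countBelow-layout zero zero (suc c) t =
  trans (cong (δ (true , true) t +_) (countBelow-layout 0 0 c t)) (proj₂ (proj₂ (columnProfile-suc 0 0 c t)))
countBelow-layout zero zero zero t = sym (columnProfile-zero t)

memℕ-toℕ : ∀ {m} (Y : SubsetX m) x → memℕ Y (suc (toℕ x)) ≡ Y x
memℕ-toℕ {m} Y x with toℕ x <? m
... | yes x<m = cong Y (fromℕ<-toℕ x x<m)
... | no  x≮m = ⊥-elim (x≮m (toℕ<n x))

memℕ-≥ : ∀ {m} (Y : SubsetX m) {p} → m ≤ p → memℕ Y (suc p) ≡ false
memℕ-≥ {m} Y {p} m≤p with p <? m
... | yes p<m = ⊥-elim (ℕ.<⇒≱ p<m m≤p)
... | no  _   = refl

rowℕ : ∀ {m} → ℕ → SubsetX m → ℕ → Bool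
rowℕ {m} i Y p = if p ≡ᵇ 2 * m + 2 then true else zℕ i Y (suc p)

row≡rowℕ : ∀ {m} i (Y : SubsetX m) j → row i Y j ≡ rowℕ i Y (toℕ j)
row≡rowℕ {m} i Y j with toℕ j ≡ᵇ 2 * m + 2
... | true  = refl
... | false = refl

2m+2≡2+[m+m] : ∀ m → 2 * m + 2 ≡ 2 + (m + m)
2m+2≡2+[m+m] = solve-∀

2m+3≡2+[m+[m+1]] : ∀ m → 2 * m + 3 ≡ 2 + (m + (m + 1))
2m+3≡2+[m+[m+1]] = solve-∀

m+[m+1]≡1+[m+m] : ∀ m → m + (m + 1) ≡ suc (m + m)
m+[m+1]≡1+[m+m] = solve-∀

module C′Columns {m : ℕ} (Y₁ Y₂ : SubsetX m) where

  columnℕ : ℕ → Column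
  columnℕ p = rowℕ 1 Y₁ p , rowℕ 2 Y₂ p

  private
    -- does (p ℕ.≟ q) reduces to p ≡ᵇ q, the test performed by rowℕ.
    rowℕ-body : ∀ i (Y : SubsetX m) {p} → p < 2 + (m + m) → rowℕ i Y p ≡ zℕ i Y (suc p)
    rowℕ-body i Y {p} p< = cong (λ b → if b then true else zℕ i Y (suc p))
                                (dec-false (p ℕ.≟ 2 * m + 2) (λ p≡ → <⇒≢ p< (trans p≡ (2m+2≡2+[m+m] m))))

    rowℕ-last : ∀ i (Y : SubsetX m) → rowℕ i Y (2 * m + 2) ≡ true
    rowℕ-last i Y = cong (λ b → if b then true else zℕ i Y (suc (2 * m + 2)))
                         (dec-true (2 * m + 2 ℕ.≟ 2 * m + 2) refl)

    first-copy : ∀ (Y : SubsetX m) x → memℕ Y (suc (toℕ x)) ∨ memℕ Y (suc (toℕ x) ∸ m) ≡ Y x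
    first-copy Y x = trans (cong₂ _∨_ (memℕ-toℕ Y x) (cong (memℕ Y) (m≤n⇒m∸n≡0 (toℕ<n x))))
                           (∨-identityʳ (Y x))

    second-copy : ∀ (Y : SubsetX m) x → memℕ Y (suc (m + toℕ x)) ∨ memℕ Y (suc (m + toℕ x) ∸ m) ≡ Y x
    second-copy Y x = cong₂ _∨_ (memℕ-≥ Y (m≤m+n m (toℕ x)))
                                (trans (cong (λ k → memℕ Y (k ∸ m)) (sym (+-suc m (toℕ x))))
                                       (trans (cong (memℕ Y) (m+n∸m≡n m (suc (toℕ x)))) (memℕ-toℕ Y x)))

    column-0 : columnℕ 0 ≡ (true , false)
    column-0 = cong₂ _,_ (rowℕ-body 1 Y₁ (s≤s z≤n)) (rowℕ-body 2 Y₂ (s≤s z≤n))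

    column-1 : columnℕ 1 ≡ (false , true)
    column-1 = cong₂ _,_ (trans (rowℕ-body 1 Y₁ (s≤s (s≤s z≤n))) (cong (memℕ Y₁) (0∸n≡0 m)))
                         (rowℕ-body 2 Y₂ (s≤s (s≤s z≤n)))

    column-first : ∀ x → columnℕ (2 + toℕ x) ≡ (Y₁ x , Y₂ x)
    column-first x = cong₂ _,_ (trans (rowℕ-body 1 Y₁ x<) (first-copy Y₁ x))
                               (trans (rowℕ-body 2 Y₂ x<) (first-copy Y₂ x))
      where
      x< : 2 + toℕ x < 2 + (m + m)
      x< = s≤s (s≤s (≤-trans (toℕ<n x) (m≤m+n m m)))

    column-second : ∀ x → columnℕ (2 + (m + toℕ x)) ≡ (Y₁ x , Y₂ x)
    column-second x = cong₂ _,_ (trans (rowℕ-body 1 Y₁ x<) (second-copy Y₁ x))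
                                (trans (rowℕ-body 2 Y₂ x<) (second-copy Y₂ x))
      where
      x< : 2 + (m + toℕ x) < 2 + (m + m)
      x< = s≤s (s≤s (+-monoʳ-< m (toℕ<n x)))

    column-last : columnℕ (2 + (m + (m + 0))) ≡ (true , true)
    column-last = trans (cong columnℕ last≡) (cong₂ _,_ (rowℕ-last 1 Y₁) (rowℕ-last 2 Y₂))
      where
      last≡ : 2 + (m + (m + 0)) ≡ 2 * m + 2
      last≡ = trans (cong (λ k → 2 + (m + k)) (+-identityʳ m)) (sym (2m+2≡2+[m+m] m))

  count-C′ : ∀ t → count (column (C′-gen Y₁ Y₂)) t ≡
    δ (true , false) t + (δ (false , true) t +
      (count (λ x → Y₁ x , Y₂ x) t + (count (λ x → Y₁ x , Y₂ x) t + (δ (true , true) t + 0))))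
  count-C′ t = begin
    count (column (C′-gen Y₁ Y₂)) t
      ≡⟨ count-cong (λ j → cong₂ _,_ (row≡rowℕ 1 Y₁ j) (row≡rowℕ 2 Y₂ j)) t ⟩
    countBelow (2 * m + 3) columnℕ t
      ≡⟨ cong (λ n → countBelow n columnℕ t) (2m+3≡2+[m+[m+1]] m) ⟩
    δ (columnℕ 0) t + (δ (columnℕ 1) t + countBelow (m + (m + 1)) (λ p → columnℕ (2 + p)) t)
      ≡⟨ cong (λ k → δ (columnℕ 0) t + (δ (columnℕ 1) t + k))
              (trans (countBelow-+ m (m + 1) (λ p → columnℕ (2 + p)) t)
                     (cong (countBelow m (λ p → columnℕ (2 + p)) t +_)
                           (countBelow-+ m 1 (λ p → columnℕ (2 + (m + p))) t))) ⟩
    δ (columnℕ 0) t + (δ (columnℕ 1) t + (countBelow m (λ p → columnℕ (2 + p)) t +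
      (countBelow m (λ p → columnℕ (2 + (m + p))) t + (δ (columnℕ (2 + (m + (m + 0)))) t + 0))))
      ≡⟨ cong₂ _+_ (cong (λ s → δ s t) column-0) (cong₂ _+_ (cong (λ s → δ s t) column-1)
           (cong₂ _+_ (count-cong column-first t)
             (cong₂ _+_ (count-cong column-second t) (cong (λ s → δ s t + 0) column-last)))) ⟩
    δ (true , false) t + (δ (false , true) t +
      (count (λ x → Y₁ x , Y₂ x) t + (count (λ x → Y₁ x , Y₂ x) t + (δ (true , true) t + 0)))) ∎

layout-subset₁ layout-subset₂ : ∀ {m} → ℕ → ℕ → SubsetX m
layout-subset₁ a b x = proj₁ (layout a b (toℕ x))
layout-subset₂ a b x = proj₂ (layout a b (toℕ x))

C′-layout-profile : ∀ {m} a b c → m ≡ a + (b + c) → ∀ t →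
  count (column (C′-gen {m} (layout-subset₁ a b) (layout-subset₂ a b))) t
    ≡ columnProfile (suc (a + a)) (suc (b + b)) (suc (c + c)) t
C′-layout-profile {m} a b c m≡ t = begin
  count (column (C′-gen {m} (layout-subset₁ a b) (layout-subset₂ a b))) t
    ≡⟨ C′Columns.count-C′ {m} (layout-subset₁ a b) (layout-subset₂ a b) t ⟩
  δ (true , false) t + (δ (false , true) t +
    (countBelow m (layout a b) t + (countBelow m (layout a b) t + (δ (true , true) t + 0))))
    ≡⟨ cong (λ k → δ (true , false) t + (δ (false , true) t + (k + (k + (δ (true , true) t + 0)))))
            (trans (cong (λ n → countBelow n (layout a b) t) m≡) (countBelow-layout a b c t)) ⟩
  δ (true , false) t + (δ (false , true) t +
    (columnProfile a b c t + (columnProfile a b c t + (δ (true , true) t + 0))))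
    ≡⟨ doubled t ⟩
  columnProfile (suc (a + a)) (suc (b + b)) (suc (c + c)) t ∎
  where
  doubled : ∀ t → δ (true , false) t + (δ (false , true) t +
    (columnProfile a b c t + (columnProfile a b c t + (δ (true , true) t + 0))))
      ≡ columnProfile (suc (a + a)) (suc (b + b)) (suc (c + c)) t
  doubled (false , false) = refl
  doubled (true  , false) = cong (suc ∘ (a +_)) (+-identityʳ a)
  doubled (false , true)  = cong (suc ∘ (b +_)) (+-identityʳ b)
  doubled (true  , true)  = m+[m+1]≡1+[m+m] c

-- The argument does not use m ≥ 1.
proposition3p4 : (m : ℕ) → 1 ≤ m → (C : Code (2 * m + 3)) →
    IsLinearCode (2 * m + 3) 2 C → IsLCD C → MinDistGe (Dual C) 2 →
    Σ (SubsetX m) λ Y₁ → Σ (SubsetX m) λ Y₂ → Is2Cover Y₁ Y₂ × Equivalent C (C′ Y₁ Y₂)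
proposition3p4 m _ C (g , indep , span) lcd d⊥≥2 =
  Y₁ , Y₂ , (λ x → layout-cover a b (toℕ x)) , σ , λ v → ⇔.trans (span v) (InSpan-permute g h σ h≡gσ v)
  where
  open OddColumnCounts (lcd⇒odd-column-counts m g indep span lcd d⊥≥2)

  Y₁ Y₂ : SubsetX m
  Y₁ = layout-subset₁ a b
  Y₂ = layout-subset₂ a b

  h : Fin 2 → Word (2 * m + 3)
  h = C′-gen Y₁ Y₂

  columns-permuted : Σ (Permutation′ (2 * m + 3)) λ σ → ∀ j → column h j ≡ column g (σ ⟨$⟩ʳ j)
  columns-permuted = ≗count⇒permutation (column g) (column h)
                       (λ t → trans (column-counts t) (sym (C′-layout-profile a b c m≡a+[b+c] t)))

  σ : Permutation′ (2 * m + 3)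
  σ = proj₁ columns-permuted

  h≡gσ : ∀ i j → h i j ≡ g i (σ ⟨$⟩ʳ j)
  h≡gσ fz      j = cong proj₁ (proj₂ columns-permuted j)
  h≡gσ (fs fz) j = cong proj₂ (proj₂ columns-permuted j)
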